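{- Let $p,t$ be positive integers, let $n_1,\dots,n_p$ be positive integers, let $X=[n]$ with $n=n_1+\cdots+n_p$, partitioned into consecutive blocks $X_1=[n_1]$ and $X_i=\left[\sum_{j\le i}n_j\right]\setminus\left[\sum_{j\le i-1}n_j\right]$ for $i=2,\dots,p$. Let $r_1,\dots,r_p,s_1,\dots,s_p$ be positive integers with $r_i,s_i\le n_i$ and $n_i>r_i+s_i-1$ for all $i\in[p]$. Let $\mathcal{A}\subset\{F\subset X:|F\cap X_i|=r_i\ \forall i\}$ and $\mathcal{B}\subset\{F\subset X:|F\cap X_i|=s_i\ \forall i\}$ be non-empty cross $t$-intersecting families. If $\mathcal{A}$ and $\mathcal{B}$ are $l$-shifted for every $l\in[p]$, then $$\sum_{i=1}^p|A\cap B\cap Q_i(r_i+s_i-1)|\ge t$$ for all $A\in\mathcal{A}$ and $B\in\mathcal{B}$.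
   Context: Two non-empty families $\mathcal{A},\mathcal{B}$ are cross $t$-intersecting if $|A\cap B|\ge t$ for all $A\in\mathcal{A}$, $B\in\mathcal{B}$. For $i,j\in X$ and $F\subset X$, $\delta_{i,j}(F)=(F\setminus\{j\})\cup\{i\}$ if $j\in F$, $i\notin F$, and $\delta_{i,j}(F)=F$ otherwise; for a family $\mathcal{F}$, $\Delta_{i,j}(\mathcal{F})=\{\delta_{i,j}(F):F\in\mathcal{F}\}\cup\{F\in\mathcal{F}:\delta_{i,j}(F)\in\mathcal{F}\}$. A family $\mathcal{F}$ is $l$-shifted if $\Delta_{i,j}(\mathcal{F})=\mathcal{F}$ for all $i,j\in X_l$ with $i<j$. For $l\in[p]$ and a positive integer $s\le n_l$, $Q_l(s)$ denotes the set of the $s$ smallest elements of $X_l$. -}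

module Defs where

open import Data.Nat using (ℕ; zero; suc; _+_; _≤_; _<_; _≤?_; _<?_)
open import Data.Fin using (Fin; zero; suc; toℕ)
open import Data.Fin.Subset using (Subset; _∈_; _∉_; _∩_; ∣_∣; inside; outside)
open import Data.Fin.Subset.Properties using (_∈?_)
open import Data.Vec.Base using (tabulate; _[_]≔_)
open import Data.Bool using (Bool; _∧_; not; if_then_else_)
open import Data.Product using (_×_; ∃; Σ)
open import Data.Sum using (_⊎_)
open import Relation.Nullary using (does; ¬_)
open import Relation.Binary.PropositionalEquality using (_≡_)
open import Function using (_∘_)

∑ : ∀ {p} → (Fin p → ℕ) → ℕ
∑ {zero} f = 0
∑ {suc p} f = f zero + ∑ (f ∘ suc)

-- n = n₁ + ⋯ + n_p ; X = Fin (total ns) (i.e. [n] shifted to start at 0).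
total : ∀ {p} → (Fin p → ℕ) → ℕ
total = ∑

offset : ∀ {p} → (Fin p → ℕ) → Fin p → ℕ
offset ns zero = 0
offset ns (suc l) = ns zero + offset (ns ∘ suc) l

interval : ∀ {p} (ns : Fin p → ℕ) → Fin p → ℕ → Subset (total ns)
interval ns l s = tabulate λ x → does (offset ns l ≤? toℕ x) ∧ does (toℕ x <? offset ns l + s)

block : ∀ {p} (ns : Fin p → ℕ) → Fin p → Subset (total ns)
block ns l = interval ns l (ns l)

-- Q_l(s): the s smallest elements of X_l
Q : ∀ {p} (ns : Fin p → ℕ) → Fin p → ℕ → Subset (total ns)
Q = interval

InBlock : ∀ {p} (ns : Fin p → ℕ) → Fin p → Fin (total ns) → Set
InBlock ns l x = x ∈ block ns l

δ : ∀ {N} → Fin N → Fin N → Subset N → Subset N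
δ i j F = if does (j ∈? F) ∧ not (does (i ∈? F))
          then (F [ j ]≔ outside) [ i ]≔ inside
          else F

Family : ℕ → Set₁
Family N = Subset N → Set

Δ : ∀ {N} → Fin N → Fin N → Family N → Family N
Δ i j 𝓕 G = (∃ λ F → 𝓕 F × δ i j F ≡ G) ⊎ (𝓕 G × 𝓕 (δ i j G))

_≐_ : ∀ {N} → Family N → Family N → Set
𝓕 ≐ 𝓖 = ∀ G → (𝓕 G → 𝓖 G) × (𝓖 G → 𝓕 G)

Shifted : ∀ {p} (ns : Fin p → ℕ) → Fin p → Family (total ns) → Set
Shifted ns l 𝓕 = ∀ i j → InBlock ns l i → InBlock ns l j → toℕ i < toℕ j → Δ i j 𝓕 ≐ 𝓕

NonEmpty : ∀ {N} → Family N → Set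
NonEmpty 𝓕 = ∃ λ F → 𝓕 F

CrossIntersecting : ∀ {N} → ℕ → Family N → Family N → Set
CrossIntersecting t 𝓐 𝓑 = ∀ A B → 𝓐 A → 𝓑 B → t ≤ ∣ A ∩ B ∣

Uniform : ∀ {p} (ns : Fin p → ℕ) → (Fin p → ℕ) → Family (total ns) → Set
Uniform ns rs 𝓕 = ∀ F → 𝓕 F → ∀ l → ∣ F ∩ block ns l ∣ ≡ rs l

module Submission where

-- Induct on |A ∩ B|. If every element of A ∩ B lies in some Q_l, the bound t ≤ |A ∩ B| splits
-- over the blocks. Otherwise some x ∈ A ∩ B lies in X_l but beyond Q_l = Q_l(r_l + s_l - 1);
-- then A and B meet Q_l in fewer than r_l and s_l points, so some y ∈ Q_l lies in neither.
-- Shifting x to y keeps A in the l-shifted family, removes x from A ∩ B, and enlarges no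
-- A ∩ B ∩ Q_k because y ∉ B.

open import Defs
open import Data.Nat using (ℕ; zero; suc; _+_; _∸_; _≤_; _<_; z≤n; s≤s)
open import Data.Nat.Properties
open import Data.Nat.Induction using (<-rec)
open import Data.Fin using (Fin; zero; suc; toℕ) renaming (_≟_ to _≟ᶠ_)
open import Data.Fin.Properties using (any?; all?; toℕ<n)
open import Data.Fin.Subset
  using (Subset; _∈_; _∉_; _⊆_; _∩_; _∪_; ∁; ⊥; ∣_∣; inside; outside)
open import Data.Fin.Subset.Properties
open import Data.Vec.Base using (Vec; []; _∷_; tabulate; _[_]=_; here; _[_]≔_)
open import Data.Vec.Properties
  using ([]=⇒lookup; lookup⇒[]=; []=-injective; lookup∘tabulate; lookup∘update; lookup∘update′)
open import Data.Bool using (Bool; T)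
open import Data.Bool.Properties using (T-≡; T-∧)
open import Data.Product using (∃; _×_; _,_; proj₁; proj₂)
open import Data.Sum using (_⊎_; inj₁; inj₂; [_,_])
open import Function using (_∘_; _⇔_; Equivalence; mk⇔)
open import Relation.Nullary using (yes; no; contradiction)
open import Relation.Nullary.Decidable using (_×-dec_; ¬?)
open import Relation.Binary.PropositionalEquality using (_≡_; _≢_; refl; sym; trans; cong; subst)

∣p∪q∣≤∣p∣+∣q∣ : ∀ {n} (p q : Subset n) → ∣ p ∪ q ∣ ≤ ∣ p ∣ + ∣ q ∣
∣p∪q∣≤∣p∣+∣q∣ []            []            = z≤n
∣p∪q∣≤∣p∣+∣q∣ (outside ∷ p) (outside ∷ q) = ∣p∪q∣≤∣p∣+∣q∣ p q
∣p∪q∣≤∣p∣+∣q∣ (outside ∷ p) (inside ∷ q)  =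
  ≤-trans (s≤s (∣p∪q∣≤∣p∣+∣q∣ p q)) (≤-reflexive (sym (+-suc ∣ p ∣ ∣ q ∣)))
∣p∪q∣≤∣p∣+∣q∣ (inside ∷ p)  (outside ∷ q) = s≤s (∣p∪q∣≤∣p∣+∣q∣ p q)
∣p∪q∣≤∣p∣+∣q∣ (inside ∷ p)  (inside ∷ q)  =
  s≤s (≤-trans (∣p∪q∣≤∣p∣+∣q∣ p q) (+-monoʳ-≤ ∣ p ∣ (n≤1+n ∣ q ∣)))

∣p∩q∣<∣p∩r∣ : ∀ {n} {p q r : Subset n} {x} →
  q ⊆ r → x ∈ p → x ∈ r → x ∉ q → ∣ p ∩ q ∣ < ∣ p ∩ r ∣
∣p∩q∣<∣p∩r∣ {p = p} {q} q⊆r x∈p x∈r x∉q = p⊂q⇒∣p∣<∣q∣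
  ( (λ z∈p∩q → let z∈p , z∈q = x∈p∩q⁻ p q z∈p∩q in x∈p∩q⁺ (z∈p , q⊆r z∈q))
  , _ , x∈p∩q⁺ (x∈p , x∈r) , x∉q ∘ proj₂ ∘ x∈p∩q⁻ p q )

∣q∩p∣+∣r∩p∣<∣p∣⇒∃∈p∉q∪r : ∀ {n} (p q r : Subset n) →
  ∣ q ∩ p ∣ + ∣ r ∩ p ∣ < ∣ p ∣ → ∃ λ y → y ∈ p × y ∉ q × y ∉ r
∣q∩p∣+∣r∩p∣<∣p∣⇒∃∈p∉q∪r p q r small with nonempty? (p ∩ ∁ (q ∪ r))
... | yes (y , y∈) =
  let y∈p , y∈∁ = x∈p∩q⁻ p (∁ (q ∪ r)) y∈
      y∉q∪r     = x∈∁p⇒x∉p y∈∁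
  in y , y∈p , y∉q∪r ∘ x∈p∪q⁺ ∘ inj₁ , y∉q∪r ∘ x∈p∪q⁺ ∘ inj₂
... | no empty = contradiction
  (≤-trans (p⊆q⇒∣p∣≤∣q∣ p⊆traces) (∣p∪q∣≤∣p∣+∣q∣ (q ∩ p) (r ∩ p))) (<⇒≱ small)
  where
  p⊆traces : p ⊆ q ∩ p ∪ r ∩ p
  p⊆traces {z} z∈p with z ∈? q | z ∈? r
  ... | yes z∈q | _       = x∈p∪q⁺ (inj₁ (x∈p∩q⁺ (z∈q , z∈p)))
  ... | no _    | yes z∈r = x∈p∪q⁺ (inj₂ (x∈p∩q⁺ (z∈r , z∈p)))
  ... | no z∉q  | no z∉r  =
    contradiction (z , x∈p∩q⁺ (z∈p , x∉p⇒x∈∁p ([ z∉q , z∉r ] ∘ x∈p∪q⁻ q r))) empty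

m+o<n+p∸1 : ∀ {m n o p} → m < n → o < p → m + o < n + p ∸ 1
m+o<n+p∸1 {m} {suc n} {o} {p} (s≤s m≤n) o<p = subst (_≤ n + p) (+-suc m o) (+-mono-≤ m≤n o<p)

∃-free-slot : ∀ {n} {q x f g : Subset n} {y} →
  q ⊆ x → ∣ f ∩ x ∣ + ∣ g ∩ x ∣ ∸ 1 ≤ ∣ q ∣ →
  y ∈ f → y ∈ g → y ∈ x → y ∉ q → ∃ λ z → z ∈ q × z ∉ f × z ∉ g
∃-free-slot {q = q} {f = f} {g} q⊆x large y∈f y∈g y∈x y∉q = ∣q∩p∣+∣r∩p∣<∣p∣⇒∃∈p∉q∪r q f g (<-≤-trans
  (m+o<n+p∸1 (∣p∩q∣<∣p∩r∣ q⊆x y∈f y∈x y∉q) (∣p∩q∣<∣p∩r∣ q⊆x y∈g y∈x y∉q)) large)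

⋃ᶠ : ∀ {p n} → (Fin p → Subset n) → Subset n
⋃ᶠ {zero}  G = ⊥
⋃ᶠ {suc p} G = G zero ∪ ⋃ᶠ (G ∘ suc)

x∈G⇒x∈⋃ᶠG : ∀ {p n} (G : Fin p → Subset n) {x} l → x ∈ G l → x ∈ ⋃ᶠ G
x∈G⇒x∈⋃ᶠG G zero    x∈G = x∈p∪q⁺ (inj₁ x∈G)
x∈G⇒x∈⋃ᶠG G (suc l) x∈G = x∈p∪q⁺ (inj₂ (x∈G⇒x∈⋃ᶠG (G ∘ suc) l x∈G))

∣⋃ᶠG∣≤∑∣G∣ : ∀ {p n} (G : Fin p → Subset n) → ∣ ⋃ᶠ G ∣ ≤ ∑ (∣_∣ ∘ G)
∣⋃ᶠG∣≤∑∣G∣ {zero} {n} G = ≤-reflexive (∣⊥∣≡0 n)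
∣⋃ᶠG∣≤∑∣G∣ {suc p}    G = ≤-trans (∣p∪q∣≤∣p∣+∣q∣ (G zero) (⋃ᶠ (G ∘ suc)))
                                   (+-monoʳ-≤ ∣ G zero ∣ (∣⋃ᶠG∣≤∑∣G∣ (G ∘ suc)))

union-bound : ∀ {p n} {C : Subset n} (G : Fin p → Subset n) →
  (∀ {x} → x ∈ C → ∃ λ l → x ∈ G l) → ∣ C ∣ ≤ ∑ (∣_∣ ∘ G)
union-bound G covered = ≤-trans
  (p⊆q⇒∣p∣≤∣q∣ λ x∈C → let l , x∈G = covered x∈C in x∈G⇒x∈⋃ᶠG G l x∈G) (∣⋃ᶠG∣≤∑∣G∣ G)

∑-mono-≤ : ∀ {p} {f g : Fin p → ℕ} → (∀ l → f l ≤ g l) → ∑ f ≤ ∑ g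
∑-mono-≤ {zero}  f≤g = z≤n
∑-mono-≤ {suc p} f≤g = +-mono-≤ (f≤g zero) (∑-mono-≤ (f≤g ∘ suc))

covered-or-escapes : ∀ {p n} (C : Subset n) (G : Fin p → Subset n) →
  (∀ {x} → x ∈ C → ∃ λ l → x ∈ G l) ⊎ (∃ λ x → x ∈ C × ∀ l → x ∉ G l)
covered-or-escapes C G with any? (λ x → x ∈? C ×-dec all? (λ l → ¬? (x ∈? G l)))
... | yes (x , x∈C , x∉G) = inj₂ (x , x∈C , x∉G)
... | no ¬escape          = inj₁ covered
  where
  covered : ∀ {x} → x ∈ C → ∃ λ l → x ∈ G l
  covered {x} x∈C with any? (λ l → x ∈? G l)
  ... | yes x∈G = x∈G
  ... | no  x∉G = contradiction (x , x∈C , λ l x∈Gₗ → x∉G (l , x∈Gₗ)) ¬escape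

run⊆p⇒len≤∣p∣ : ∀ {N} (p : Subset N) lo len → lo + len ≤ N →
  (∀ {x} → lo ≤ toℕ x → toℕ x < lo + len → x ∈ p) → len ≤ ∣ p ∣
run⊆p⇒len≤∣p∣ p       lo       zero      _         _   = z≤n
run⊆p⇒len≤∣p∣ []      zero     (suc len) ()        _
run⊆p⇒len≤∣p∣ []      (suc lo) (suc len) ()        _
run⊆p⇒len≤∣p∣ (b ∷ p) (suc lo) len       (s≤s fit) run =
  ≤-trans (run⊆p⇒len≤∣p∣ p lo len fit (λ lo≤x x<end → drop-there (run (s≤s lo≤x) (s≤s x<end))))
          (∣p∣≤∣x∷p∣ b p)
run⊆p⇒len≤∣p∣ (b ∷ p) zero     (suc len) (s≤s fit) run with run {zero} z≤n (s≤s z≤n)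
... | here = s≤s (run⊆p⇒len≤∣p∣ p zero len fit (λ _ x<len → drop-there (run z≤n (s≤s x<len))))

x∈tabulate⇔T : ∀ {n} (f : Fin n → Bool) {x} → x ∈ tabulate f ⇔ T (f x)
x∈tabulate⇔T f {x} = mk⇔
  (λ x∈ → Equivalence.from T-≡ (trans (sym (lookup∘tabulate f x)) ([]=⇒lookup x∈)))
  (λ fx → lookup⇒[]= x (tabulate f) (trans (lookup∘tabulate f x) (Equivalence.to T-≡ fx)))

offset+n≤total : ∀ {p} (ns : Fin p → ℕ) l → offset ns l + ns l ≤ total ns
offset+n≤total ns zero    = m≤m+n (ns zero) _
offset+n≤total ns (suc l) = begin
  ns zero + offset (ns ∘ suc) l + ns (suc l)   ≡⟨ +-assoc (ns zero) _ _ ⟩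
  ns zero + (offset (ns ∘ suc) l + ns (suc l)) ≤⟨ +-monoʳ-≤ (ns zero) (offset+n≤total (ns ∘ suc) l) ⟩
  ns zero + total (ns ∘ suc)                   ∎
  where open ≤-Reasoning

∃-block : ∀ {p} (ns : Fin p → ℕ) v → v < total ns →
  ∃ λ l → offset ns l ≤ v × v < offset ns l + ns l
∃-block {suc p} ns v v<n with v <? ns zero
... | yes v<n₀ = zero , z≤n , v<n₀
... | no  v≮n₀ with m≤n⇒∃[o]m+o≡n (≮⇒≥ v≮n₀)
...   | w , refl with ∃-block (ns ∘ suc) w (+-cancelˡ-< (ns zero) w _ v<n)
...     | l , lo≤w , w<hi =
  suc l , +-monoʳ-≤ (ns zero) lo≤w ,
  subst (ns zero + w <_) (sym (+-assoc (ns zero) _ _)) (+-monoʳ-< (ns zero) w<hi)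

module _ {p} (ns : Fin p → ℕ) (l : Fin p) where

  ∈interval⁺ : ∀ {s x} → offset ns l ≤ toℕ x → toℕ x < offset ns l + s → x ∈ interval ns l s
  ∈interval⁺ lo≤x x<hi =
    Equivalence.from (x∈tabulate⇔T _) (Equivalence.from T-∧ (≤⇒≤ᵇ lo≤x , ≤⇒≤ᵇ x<hi))

  ∈interval⁻ : ∀ {s x} → x ∈ interval ns l s → offset ns l ≤ toℕ x × toℕ x < offset ns l + s
  ∈interval⁻ x∈ = let lo≤x , x<hi = Equivalence.to T-∧ (Equivalence.to (x∈tabulate⇔T _) x∈) in
    ≤ᵇ⇒≤ _ _ lo≤x , ≤ᵇ⇒≤ _ _ x<hi

  Q⊆block : ∀ {s} → s ≤ ns l → Q ns l s ⊆ block ns l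
  Q⊆block s≤n x∈Q = let lo≤x , x<hi = ∈interval⁻ x∈Q in
    ∈interval⁺ lo≤x (<-≤-trans x<hi (+-monoʳ-≤ (offset ns l) s≤n))

  s≤∣Q∣ : ∀ {s} → s ≤ ns l → s ≤ ∣ Q ns l s ∣
  s≤∣Q∣ {s} s≤n = run⊆p⇒len≤∣p∣ (Q ns l s) (offset ns l) s
    (≤-trans (+-monoʳ-≤ (offset ns l) s≤n) (offset+n≤total ns l)) ∈interval⁺

  Q-below : ∀ {s x y} → y ∈ Q ns l s → x ∈ block ns l → x ∉ Q ns l s → toℕ y < toℕ x
  Q-below y∈Q x∈X x∉Q = <-≤-trans (proj₂ (∈interval⁻ y∈Q))
    (≮⇒≥ (x∉Q ∘ ∈interval⁺ (proj₁ (∈interval⁻ x∈X))))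

block-of : ∀ {p} (ns : Fin p → ℕ) x → ∃ λ l → x ∈ block ns l
block-of ns x = let l , lo≤x , x<hi = ∃-block ns (toℕ x) (toℕ<n x) in l , ∈interval⁺ ns l lo≤x x<hi

[]≔-minimal⁻ : ∀ {a} {A : Set a} {n} {xs : Vec A n} {i j : Fin n} {x y : A} →
  j ≢ i → (xs [ i ]≔ y) [ j ]= x → xs [ j ]= x
[]≔-minimal⁻ {xs = xs} {i} {j} {y = y} j≢i j↦x =
  lookup⇒[]= j xs (trans (sym (lookup∘update′ j≢i xs y)) ([]=⇒lookup j↦x))

∈δ⇒∈ : ∀ {N} {x y z : Fin N} {F} → z ≢ y → z ∈ δ y x F → z ∈ F
∈δ⇒∈ {x = x} {y} {z} {F} z≢y z∈δ with x ∈? F | y ∈? F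
... | no  _ | _     = z∈δ
... | yes _ | yes _ = z∈δ
... | yes _ | no  _ with z ≟ᶠ x
...   | no  z≢x  = []≔-minimal⁻ z≢x ([]≔-minimal⁻ z≢y z∈δ)
...   | yes refl = contradiction
  ([]=-injective ([]≔-minimal⁻ z≢y z∈δ) (lookup⇒[]= z _ (lookup∘update z F outside))) λ ()

x∉δ : ∀ {N} {x y : Fin N} {F} → x ≢ y → y ∉ F → x ∉ δ y x F
x∉δ {x = x} {y} {F} x≢y y∉F with x ∈? F | y ∈? F
... | _      | yes y∈F = contradiction y∈F y∉F
... | no x∉F | no _    = x∉F
... | yes _  | no _    = λ x∈δ → contradiction
  ([]=-injective ([]≔-minimal⁻ x≢y x∈δ) (lookup⇒[]= x _ (lookup∘update x F outside))) λ ()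

δ∩⊆∩ : ∀ {N} {x y : Fin N} {F G} → y ∉ G → δ y x F ∩ G ⊆ F ∩ G
δ∩⊆∩ {G = G} y∉G z∈δ∩G = let z∈δ , z∈G = x∈p∩q⁻ _ G z∈δ∩G in
  x∈p∩q⁺ (∈δ⇒∈ (λ { refl → y∉G z∈G }) z∈δ , z∈G)

δ-closed : ∀ {p} {ns : Fin p → ℕ} {l 𝓕} → Shifted ns l 𝓕 →
  ∀ {F x y} → 𝓕 F → y ∈ block ns l → x ∈ block ns l → toℕ y < toℕ x → 𝓕 (δ y x F)
δ-closed shifted {F} {x} {y} F∈𝓕 y∈X x∈X y<x =
  proj₁ (shifted y x y∈X x∈X y<x (δ y x F)) (inj₁ (F , F∈𝓕 , refl))

module _ {p} (ns rs ss : Fin p → ℕ) (𝓐 : Family (total ns)) (B : Subset (total ns))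
         (m≤n : ∀ l → rs l + ss l ∸ 1 ≤ ns l)
         (uniform-𝓐 : Uniform ns rs 𝓐) (uniform-B : ∀ l → ∣ B ∩ block ns l ∣ ≡ ss l)
         (shifted : ∀ l → Shifted ns l 𝓐) where

  private
    Qₗ : Fin p → Subset (total ns)
    Qₗ l = Q ns l (rs l + ss l ∸ 1)

    traces≤∣Qₗ∣ : ∀ {A} → 𝓐 A → ∀ l → ∣ A ∩ block ns l ∣ + ∣ B ∩ block ns l ∣ ∸ 1 ≤ ∣ Qₗ l ∣
    traces≤∣Qₗ∣ {A} A∈𝓐 l rewrite uniform-𝓐 A A∈𝓐 l | uniform-B l = s≤∣Q∣ ns l (m≤n l)

  shift-out : ∀ {A} → 𝓐 A → ∀ {x} → x ∈ A ∩ B → (∀ l → x ∉ Qₗ l) →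
    ∃ λ A′ → 𝓐 A′ × ∣ A′ ∩ B ∣ < ∣ A ∩ B ∣ × (∀ l → ∣ A′ ∩ B ∩ Qₗ l ∣ ≤ ∣ A ∩ B ∩ Qₗ l ∣)
  shift-out {A} A∈𝓐 {x} x∈A∩B x∉Q with x∈p∩q⁻ A B x∈A∩B | block-of ns x
  ... | x∈A , x∈B | l , x∈X
    with ∃-free-slot (Q⊆block ns l (m≤n l)) (traces≤∣Qₗ∣ A∈𝓐 l) x∈A x∈B x∈X (x∉Q l)
  ... | y , y∈Q , y∉A , y∉B =
    δ y x A ,
    δ-closed {ns = ns} {l} (shifted l) A∈𝓐 (Q⊆block ns l (m≤n l) y∈Q) x∈X y<x ,
    p⊂q⇒∣p∣<∣q∣ (δ∩⊆∩ {F = A} y∉B , x , x∈A∩B , x∉δ {F = A} x≢y y∉A ∘ proj₁ ∘ x∈p∩q⁻ _ B) ,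
    λ l′ → p⊆q⇒∣p∣≤∣q∣ (δ∩⊆∩ {x = x} {F = A} (y∉B ∘ proj₁ ∘ x∈p∩q⁻ B (Qₗ l′)))
    where
    y<x : toℕ y < toℕ x
    y<x = Q-below ns l y∈Q x∈X (x∉Q l)
    x≢y : x ≢ y
    x≢y x≡y = <⇒≢ y<x (cong toℕ (sym x≡y))

  ≤∑∣A∩B∩Q∣ : ∀ {t} → (∀ A → 𝓐 A → t ≤ ∣ A ∩ B ∣) →
    ∀ A → 𝓐 A → t ≤ ∑ (λ l → ∣ A ∩ B ∩ Qₗ l ∣)
  ≤∑∣A∩B∩Q∣ {t} intersecting A A∈𝓐 = <-rec P step ∣ A ∩ B ∣ A A∈𝓐 refl
    where
    P : ℕ → Set
    P k = ∀ A → 𝓐 A → ∣ A ∩ B ∣ ≡ k → t ≤ ∑ (λ l → ∣ A ∩ B ∩ Qₗ l ∣)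
    step : ∀ k → (∀ {j} → j < k → P j) → P k
    step _ rec A A∈𝓐 refl with covered-or-escapes (A ∩ B) Qₗ
    ... | inj₁ covered = ≤-trans (intersecting A A∈𝓐) (union-bound (λ l → A ∩ B ∩ Qₗ l) λ z∈A∩B →
      let l , z∈Q = covered z∈A∩B ; z∈A , z∈B = x∈p∩q⁻ A B z∈A∩B in
      l , x∈p∩q⁺ (z∈A , x∈p∩q⁺ (z∈B , z∈Q)))
    ... | inj₂ (x , x∈A∩B , x∉Q) =
      let A′ , A′∈𝓐 , smaller , pointwise = shift-out A∈𝓐 x∈A∩B x∉Q in
      ≤-trans (rec smaller A′ A′∈𝓐 refl) (∑-mono-≤ pointwise)

lemma2p2 : (p t : ℕ) → 1 ≤ p → 1 ≤ t →
    (ns rs ss : Fin p → ℕ) →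
    (∀ l → 1 ≤ ns l) → (∀ l → 1 ≤ rs l) → (∀ l → 1 ≤ ss l) →
    (∀ l → rs l ≤ ns l) → (∀ l → ss l ≤ ns l) →
    (∀ l → rs l + ss l ∸ 1 < ns l) →
    (𝓐 𝓑 : Family (total ns)) →
    Uniform ns rs 𝓐 → Uniform ns ss 𝓑 →
    NonEmpty 𝓐 → NonEmpty 𝓑 →
    CrossIntersecting t 𝓐 𝓑 →
    (∀ l → Shifted ns l 𝓐) → (∀ l → Shifted ns l 𝓑) →
    ∀ A B → 𝓐 A → 𝓑 B →
    t ≤ ∑ (λ l → ∣ A ∩ B ∩ Q ns l (rs l + ss l ∸ 1) ∣)
lemma2p2 _ _ _ _ ns rs ss _ _ _ _ _ m<n 𝓐 𝓑 uniform-𝓐 uniform-𝓑 _ _ cross shifted-𝓐 _ A B A∈𝓐 B∈𝓑 =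
  ≤∑∣A∩B∩Q∣ ns rs ss 𝓐 B (<⇒≤ ∘ m<n) uniform-𝓐 (uniform-𝓑 B B∈𝓑) shifted-𝓐
    (λ A′ A′∈𝓐 → cross A′ B A′∈𝓐 B∈𝓑) A A∈𝓐
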